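{- Let $K$ be a field of characteristic zero. (1) For formal power series $f_k(t)\in K[[t]]$, $k\ge 0$, the formal sum of operators $\sum_{k=0}^{\infty}f_k(D)\,X^k$ on $K[x]$ converges in the discrete topology if and only if $\lim_{k\to\infty}[\operatorname{ord}(f_k)-k]=+\infty$. (2) For polynomials $a_k(x)\in K[x]$, $k\ge0$, the formal sum $\sum_{k=0}^{\infty}D^k\,a_k(X)$ converges in the discrete topology if and only if $\lim_{k\to\infty}[k-\deg(a_k)]=+\infty$.
   Context: $D$ is differentiation and $X$ multiplication by $x$ on $K[x]$; $f(D)=\sum_j c_jD^j$ for $f=\sum_jc_jt^j$, and $a(X)$ is multiplication by $a(x)$. The order $\operatorname{ord}(f)$ of a nonzero series $f=\sum c_kt^k$ is the least $j$ with $c_j\neq0$; $\operatorname{ord}(0)=+\infty$; the zero polynomial has degree $-\infty$. A sum of operators converges in the discrete topology if for every polynomial $p$ the sequence of partial sums applied to $p$ is eventually constant. -}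

module Defs where

open import Level using (Level; _⊔_) renaming (suc to lsuc)
open import Algebra.Bundles using (CommutativeRing)
open import Data.Nat using (ℕ; zero; suc; _≤_; _<_; _∸_) renaming (_+_ to _+ℕ_)
open import Data.List using (List; []; _∷_; map; replicate; _++_; length)
open import Data.Product using (∃; _×_)
open import Relation.Nullary using (¬_)

record Field (c ℓ : Level) : Set (lsuc (c ⊔ ℓ)) where
  field
    commutativeRing : CommutativeRing c ℓ
  open CommutativeRing commutativeRing public
  field
    0≉1     : ¬ (0# ≈ 1#)
    inverse : ∀ x → ¬ (x ≈ 0#) → ∃ λ y → x * y ≈ 1#

module Poly {c ℓ : Level} (K : Field c ℓ) where
  open Field K

  natMul : ℕ → Carrier → Carrier
  natMul zero    x = 0#
  natMul (suc n) x = x + natMul n x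

  CharZero : Set ℓ
  CharZero = ∀ n → ¬ (natMul (suc n) 1# ≈ 0#)

  -- polynomials in K[x] as coefficient lists (constant term first)
  Pol : Set c
  Pol = List Carrier

  coeff : Pol → ℕ → Carrier
  coeff []       i       = 0#
  coeff (a ∷ as) zero    = a
  coeff (a ∷ as) (suc i) = coeff as i

  -- equality of polynomials (coefficientwise; trailing zeros irrelevant)
  _≈ₚ_ : Pol → Pol → Set ℓ
  p ≈ₚ q = ∀ i → coeff p i ≈ coeff q i

  _+ₚ_ : Pol → Pol → Pol
  []       +ₚ q        = q
  (a ∷ as) +ₚ []       = a ∷ as
  (a ∷ as) +ₚ (b ∷ bs) = (a + b) ∷ (as +ₚ bs)

  scale : Carrier → Pol → Pol
  scale a p = map (a *_) p

  _*ₚ_ : Pol → Pol → Pol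
  []       *ₚ q = []
  (a ∷ as) *ₚ q = scale a q +ₚ (0# ∷ (as *ₚ q))

  psum : ℕ → (ℕ → Pol) → Pol
  psum zero    g = []
  psum (suc n) g = psum n g +ₚ g n

  derivFrom : ℕ → Pol → Pol
  derivFrom n []       = []
  derivFrom n (b ∷ bs) = natMul n b ∷ derivFrom (suc n) bs

  D : Pol → Pol
  D []       = []
  D (a ∷ as) = derivFrom 1 as

  Dpow : ℕ → Pol → Pol
  Dpow zero    p = p
  Dpow (suc j) p = D (Dpow j p)

  Xpow : ℕ → Pol → Pol
  Xpow k p = replicate k 0# ++ p

  mulOp : Pol → Pol → Pol
  mulOp a p = a *ₚ p

  PowerSeries : Set c
  PowerSeries = ℕ → Carrier

  -- f(D) p = Σ_j f_j D^j p ; terms with j ≥ length p vanish since D^j p = 0,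
  -- so the sum is exactly the finite sum over j ≤ length p.
  applyD : PowerSeries → Pol → Pol
  applyD f p = psum (suc (length p)) (λ j → scale (f j) (Dpow j p))

  -- A formal sum Σ_k T_k of operators converges in the discrete topology:
  -- for every polynomial p the partial sums Σ_{k<n} T_k p are eventually constant.
  Converges : (ℕ → Pol → Pol) → Set (c ⊔ ℓ)
  Converges T = ∀ p → ∃ λ N → ∀ n → N ≤ n →
                  psum n (λ k → T k p) ≈ₚ psum N (λ k → T k p)

  -- ord(f) ≥ n  (with ord 0 = +∞)
  OrdAtLeast : PowerSeries → ℕ → Set ℓ
  OrdAtLeast f n = ∀ j → j < n → f j ≈ 0#

  -- deg(a) < n  (with deg 0 = -∞)
  DegLessThan : Pol → ℕ → Set ℓ
  DegLessThan a n = ∀ i → n ≤ i → coeff a i ≈ 0#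

  -- lim_{k→∞} [ord(f_k) - k] = +∞ :  ∀ M ∃ N ∀ k ≥ N, ord(f_k) ≥ k + M
  OrdMinusIndexToInfinity : (ℕ → PowerSeries) → Set ℓ
  OrdMinusIndexToInfinity f =
    ∀ M → ∃ λ N → ∀ k → N ≤ k → OrdAtLeast (f k) (k +ℕ M)

  -- lim_{k→∞} [k - deg(a_k)] = +∞ :  ∀ M ∃ N ∀ k ≥ N, deg(a_k) ≤ k - M,
  -- i.e. deg(a_k) < (k + 1) ∸ M  (for M > k this says a_k = 0, as deg 0 = -∞)
  IndexMinusDegToInfinity : (ℕ → Pol) → Set ℓ
  IndexMinusDegToInfinity a =
    ∀ M → ∃ λ N → ∀ k → N ≤ k → DegLessThan (a k) (suc k ∸ M)

-- A sum of operators converges in the discrete topology exactly when its terms eventually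
-- annihilate each fixed polynomial. D sends the coefficient c of x^(i+1) to (i+1)c, which in
-- characteristic zero vanishes only if c does; so D^j p = 0 iff deg p < j. Hence f_k(D) X^k
-- kills all polynomials of degree < n iff ord(f_k) ≥ k + n, and D^k a_k(X) kills them iff
-- deg a_k ≤ k - n; in both cases the monomial x^n is the decisive test polynomial.
module Submission where

open import Defs
open import Level using (Level)
import Algebra.Properties.Ring as RingProperties
open import Data.Nat
  using (ℕ; zero; suc; _≤_; _<_; _∸_; _⊔_; z≤n; s≤s; _≟_; _<?_)
  renaming (_+_ to _+ℕ_)
open import Data.Nat.Properties
  using ( ≤-refl; ≤-trans; <⇒≢; ≮⇒≥; ≤∧≢⇒<; ≤-pred; m≤n⇒m≤1+n; n≤1+n; m≤n+m
        ; m+n≤o⇒n≤o; m≤n+m∸n; +-monoʳ-≤; ∸-monoˡ-≤; m∸n+n≡m; +-cancelˡ-≡; +-suc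
        ; m≤m⊔n; m≤n⊔m )
  renaming (+-identityʳ to +ℕ-identityʳ)
open import Data.List using ([]; _∷_; length; replicate)
open import Data.List.Properties using (length-++; length-replicate)
open import Data.Product using (_×_; _,_; ∃)
open import Data.Empty using (⊥-elim)
open import Function.Base using (_∘_)
open import Function.Bundles using (_⇔_; mk⇔)
open import Relation.Nullary using (¬_; yes; no)
open import Relation.Binary.PropositionalEquality as ≡ using (_≡_)
import Relation.Binary.Reasoning.Setoid as SetoidReasoning

module _ {c ℓ : Level} (K : Field c ℓ) where
  open Field K hiding (zero)
  open Poly K
  open RingProperties ring using (+-identityʳ-unique)
  open SetoidReasoning setoid

  x*y≈0⇒y≈0 : ∀ {x y} → ¬ (x ≈ 0#) → x * y ≈ 0# → y ≈ 0#
  x*y≈0⇒y≈0 {x} {y} x≉0 xy≈0 with inverse x x≉0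
  ... | z , xz≈1 = begin
    y             ≈⟨ *-identityˡ y ⟨
    1# * y        ≈⟨ *-congʳ (trans (sym xz≈1) (*-comm x z)) ⟩
    (z * x) * y   ≈⟨ *-assoc z x y ⟩
    z * (x * y)   ≈⟨ *-congˡ xy≈0 ⟩
    z * 0#        ≈⟨ zeroʳ z ⟩
    0#            ∎

  natMul≈natMul1* : ∀ n y → natMul n y ≈ natMul n 1# * y
  natMul≈natMul1* zero    y = sym (zeroˡ y)
  natMul≈natMul1* (suc n) y = begin
    y + natMul n y             ≈⟨ +-cong (sym (*-identityˡ y)) (natMul≈natMul1* n y) ⟩
    1# * y + natMul n 1# * y   ≈⟨ distribʳ y 1# (natMul n 1#) ⟨
    (1# + natMul n 1#) * y     ∎

  natMul-congʳ : ∀ n {x y} → x ≈ y → natMul n x ≈ natMul n y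
  natMul-congʳ n {x} {y} x≈y = begin
    natMul n x         ≈⟨ natMul≈natMul1* n x ⟩
    natMul n 1# * x    ≈⟨ *-congˡ x≈y ⟩
    natMul n 1# * y    ≈⟨ natMul≈natMul1* n y ⟨
    natMul n y         ∎

  natMul-zeroʳ : ∀ n → natMul n 0# ≈ 0#
  natMul-zeroʳ n = trans (natMul≈natMul1* n 0#) (zeroʳ _)

  coeff-+ₚ : ∀ p q i → coeff (p +ₚ q) i ≈ coeff p i + coeff q i
  coeff-+ₚ []       q        i       = sym (+-identityˡ _)
  coeff-+ₚ (a ∷ as) []       i       = sym (+-identityʳ _)
  coeff-+ₚ (a ∷ as) (b ∷ bs) zero    = refl
  coeff-+ₚ (a ∷ as) (b ∷ bs) (suc i) = coeff-+ₚ as bs i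

  coeff-scale : ∀ a p i → coeff (scale a p) i ≈ a * coeff p i
  coeff-scale a []       i       = sym (zeroʳ a)
  coeff-scale a (b ∷ bs) zero    = refl
  coeff-scale a (b ∷ bs) (suc i) = coeff-scale a bs i

  coeff-derivFrom : ∀ n p i → coeff (derivFrom n p) i ≈ natMul (n +ℕ i) (coeff p i)
  coeff-derivFrom n []       i       = sym (natMul-zeroʳ (n +ℕ i))
  coeff-derivFrom n (b ∷ bs) zero    rewrite +ℕ-identityʳ n = refl
  coeff-derivFrom n (b ∷ bs) (suc i) rewrite +-suc n i = coeff-derivFrom (suc n) bs i

  coeff-D : ∀ p i → coeff (D p) i ≈ natMul (suc i) (coeff p (suc i))
  coeff-D []       i = sym (natMul-zeroʳ (suc i))
  coeff-D (a ∷ as) i = coeff-derivFrom 1 as i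

  coeff-Dpow≈0 : ∀ j p i → coeff p (i +ℕ j) ≈ 0# → coeff (Dpow j p) i ≈ 0#
  coeff-Dpow≈0 zero    p i c≈0 rewrite +ℕ-identityʳ i = c≈0
  coeff-Dpow≈0 (suc j) p i c≈0 rewrite +-suc i j = begin
    coeff (D (Dpow j p)) i                     ≈⟨ coeff-D (Dpow j p) i ⟩
    natMul (suc i) (coeff (Dpow j p) (suc i))  ≈⟨ natMul-congʳ (suc i) (coeff-Dpow≈0 j p (suc i) c≈0) ⟩
    natMul (suc i) 0#                          ≈⟨ natMul-zeroʳ (suc i) ⟩
    0#                                         ∎

  coeff-length : ∀ p i → length p ≤ i → coeff p i ≈ 0#
  coeff-length []       i       _         = refl
  coeff-length (a ∷ as) (suc i) (s≤s len) = coeff-length as i len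

  degLessThan-length : ∀ p → DegLessThan p (length p)
  degLessThan-length = coeff-length

  degLessThan-mono : ∀ p {m n} → m ≤ n → DegLessThan p m → DegLessThan p n
  degLessThan-mono p m≤n deg i n≤i = deg i (≤-trans m≤n n≤i)

  degLessThan-Xpow : ∀ k p → DegLessThan (Xpow k p) (k +ℕ length p)
  degLessThan-Xpow k p = ≡.subst (DegLessThan (Xpow k p)) length-Xpow (degLessThan-length (Xpow k p))
    where
    length-Xpow : length (Xpow k p) ≡ k +ℕ length p
    length-Xpow = ≡.trans (length-++ (replicate k 0#)) (≡.cong (_+ℕ length p) (length-replicate k))

  Dpow≈0 : ∀ j p → DegLessThan p j → Dpow j p ≈ₚ []
  Dpow≈0 j p deg i = coeff-Dpow≈0 j p i (deg (i +ℕ j) (m≤n+m j i))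

  *ₚ-zeroˡ : ∀ p q → p ≈ₚ [] → (p *ₚ q) ≈ₚ []
  *ₚ-zeroˡ []       q p≈0 m = refl
  *ₚ-zeroˡ (a ∷ as) q p≈0 m = begin
    coeff (scale a q +ₚ (0# ∷ (as *ₚ q))) m         ≈⟨ coeff-+ₚ (scale a q) _ m ⟩
    coeff (scale a q) m + coeff (0# ∷ (as *ₚ q)) m  ≈⟨ +-cong head (tail m) ⟩
    0# + 0#                                         ≈⟨ +-identityˡ 0# ⟩
    0#                                              ∎
    where
    head : coeff (scale a q) m ≈ 0#
    head = trans (coeff-scale a q m) (trans (*-congʳ (p≈0 zero)) (zeroˡ _))
    tail : ∀ m → coeff (0# ∷ (as *ₚ q)) m ≈ 0#
    tail zero    = refl
    tail (suc m) = *ₚ-zeroˡ as q (p≈0 ∘ suc) m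

  degLessThan-*ₚ : ∀ p q {A L} → DegLessThan p A → DegLessThan q L →
                   DegLessThan (p *ₚ q) (A +ℕ L)
  degLessThan-*ₚ []       q         degp degq m _  = refl
  degLessThan-*ₚ (a ∷ as) q {zero}  degp degq m _  = *ₚ-zeroˡ (a ∷ as) q (λ i → degp i z≤n) m
  degLessThan-*ₚ (a ∷ as) q {suc A} degp degq m le = begin
    coeff (scale a q +ₚ (0# ∷ (as *ₚ q))) m         ≈⟨ coeff-+ₚ (scale a q) _ m ⟩
    coeff (scale a q) m + coeff (0# ∷ (as *ₚ q)) m  ≈⟨ +-cong head (tail m le) ⟩
    0# + 0#                                         ≈⟨ +-identityˡ 0# ⟩
    0#                                              ∎
    where
    head : coeff (scale a q) m ≈ 0#
    head = trans (coeff-scale a q m) (trans (*-congˡ (degq m (m+n≤o⇒n≤o (suc A) le))) (zeroʳ a))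
    tail : ∀ m → suc A +ℕ _ ≤ m → coeff (0# ∷ (as *ₚ q)) m ≈ 0#
    tail (suc m) (s≤s le) = degLessThan-*ₚ as q (λ i A≤i → degp (suc i) (s≤s A≤i)) degq m le

  coeff-psum≈0 : ∀ n g i → (∀ k → k < n → coeff (g k) i ≈ 0#) → coeff (psum n g) i ≈ 0#
  coeff-psum≈0 zero    g i _     = refl
  coeff-psum≈0 (suc n) g i terms = begin
    coeff (psum n g +ₚ g n) i           ≈⟨ coeff-+ₚ (psum n g) (g n) i ⟩
    coeff (psum n g) i + coeff (g n) i  ≈⟨ +-cong (coeff-psum≈0 n g i (λ k → terms k ∘ m≤n⇒m≤1+n))
                                                  (terms n ≤-refl) ⟩
    0# + 0#                             ≈⟨ +-identityˡ 0# ⟩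
    0#                                  ∎

  coeff-psum-single : ∀ n g i j → j < n → (∀ k → k < n → ¬ (k ≡ j) → coeff (g k) i ≈ 0#) →
                      coeff (psum n g) i ≈ coeff (g j) i
  coeff-psum-single (suc n) g i j j<1+n others with j ≟ n
  ... | yes ≡.refl = begin
    coeff (psum n g +ₚ g n) i           ≈⟨ coeff-+ₚ (psum n g) (g n) i ⟩
    coeff (psum n g) i + coeff (g n) i  ≈⟨ +-congʳ (coeff-psum≈0 n g i
                                             (λ k k<n → others k (m≤n⇒m≤1+n k<n) (<⇒≢ k<n))) ⟩
    0# + coeff (g n) i                  ≈⟨ +-identityˡ _ ⟩
    coeff (g n) i                       ∎
  ... | no j≢n = begin
    coeff (psum n g +ₚ g n) i           ≈⟨ coeff-+ₚ (psum n g) (g n) i ⟩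
    coeff (psum n g) i + coeff (g n) i  ≈⟨ +-cong (coeff-psum-single n g i j j<n (λ k → others k ∘ m≤n⇒m≤1+n))
                                                  (others n ≤-refl (j≢n ∘ ≡.sym)) ⟩
    coeff (g j) i + 0#                  ≈⟨ +-identityʳ _ ⟩
    coeff (g j) i                       ∎
    where
    j<n : j < n
    j<n = ≤∧≢⇒< (≤-pred j<1+n) j≢n

  EventuallyZero : (ℕ → Pol → Pol) → Set (c Level.⊔ ℓ)
  EventuallyZero T = ∀ p → ∃ λ N → ∀ k → N ≤ k → T k p ≈ₚ []

  converges⇒eventuallyZero : ∀ T → Converges T → EventuallyZero T
  converges⇒eventuallyZero T conv p with conv p
  ... | N , stable = N , λ k N≤k i → +-identityʳ-unique _ _ (begin
    coeff (psum k g) i + coeff (g k) i  ≈⟨ coeff-+ₚ (psum k g) (g k) i ⟨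
    coeff (psum (suc k) g) i            ≈⟨ stable (suc k) (m≤n⇒m≤1+n N≤k) i ⟩
    coeff (psum N g) i                  ≈⟨ stable k N≤k i ⟨
    coeff (psum k g) i                  ∎)
    where
    g = λ k → T k p

  eventuallyZero⇒converges : ∀ T → EventuallyZero T → Converges T
  eventuallyZero⇒converges T ev p with ev p
  ... | N , vanish = N , λ n N≤n →
    ≡.subst (λ m → psum m g ≈ₚ psum N g) (m∸n+n≡m N≤n) (stable (n ∸ N))
    where
    g = λ k → T k p
    stable : ∀ d → psum (d +ℕ N) g ≈ₚ psum N g
    stable zero    i = refl
    stable (suc d) i = begin
      coeff (psum (d +ℕ N) g +ₚ g (d +ℕ N)) i           ≈⟨ coeff-+ₚ (psum (d +ℕ N) g) _ i ⟩
      coeff (psum (d +ℕ N) g) i + coeff (g (d +ℕ N)) i  ≈⟨ +-cong (stable d i)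
                                                                   (vanish (d +ℕ N) (m≤n+m N d) i) ⟩
      coeff (psum N g) i + 0#                           ≈⟨ +-identityʳ _ ⟩
      coeff (psum N g) i                                ∎

  applyD≈0 : ∀ F p n → OrdAtLeast F n → DegLessThan p n → applyD F p ≈ₚ []
  applyD≈0 F p n ord deg i = coeff-psum≈0 _ _ i term
    where
    term : ∀ j → j < suc (length p) → coeff (scale (F j) (Dpow j p)) i ≈ 0#
    term j _ with j <? n
    ... | yes j<n = trans (coeff-scale (F j) (Dpow j p) i) (trans (*-congʳ (ord j j<n)) (zeroˡ _))
    ... | no  j≮n = trans (coeff-scale (F j) (Dpow j p) i)
                          (trans (*-congˡ (Dpow≈0 j p (degLessThan-mono p (≮⇒≥ j≮n) deg) i)) (zeroʳ _))

  ordMinusIndexToInfinity⇒eventuallyZero :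
    ∀ f → OrdMinusIndexToInfinity f → EventuallyZero (λ k p → applyD (f k) (Xpow k p))
  ordMinusIndexToInfinity⇒eventuallyZero f ord p with ord (length p)
  ... | N , ordₖ = N , λ k N≤k →
    applyD≈0 (f k) (Xpow k p) (k +ℕ length p) (ordₖ k N≤k) (degLessThan-Xpow k p)

  -- Testing at M = length p + 1 gives deg a_k < k - length p, so deg (a_k p) < k.
  indexMinusDegToInfinity⇒eventuallyZero :
    ∀ a → IndexMinusDegToInfinity a → EventuallyZero (λ k p → Dpow k (mulOp (a k) p))
  indexMinusDegToInfinity⇒eventuallyZero a deg p with deg (suc (length p))
  ... | N , degₖ = N ⊔ length p , λ k N⊔L≤k →
    let N≤k = ≤-trans (m≤m⊔n N (length p)) N⊔L≤k
        L≤k = ≤-trans (m≤n⊔m N (length p)) N⊔L≤k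
    in Dpow≈0 k (a k *ₚ p) (≡.subst (DegLessThan (a k *ₚ p)) (m∸n+n≡m L≤k)
         (degLessThan-*ₚ (a k) p (degₖ k N≤k) (degLessThan-length p)))

  monomial : ℕ → Pol
  monomial n = Xpow n (1# ∷ [])

  length-monomial : ∀ n → length (monomial n) ≡ suc n
  length-monomial zero    = ≡.refl
  length-monomial (suc n) = ≡.cong suc (length-monomial n)

  coeff-monomial-≡ : ∀ n → coeff (monomial n) n ≈ 1#
  coeff-monomial-≡ zero    = refl
  coeff-monomial-≡ (suc n) = coeff-monomial-≡ n

  coeff-monomial-≢ : ∀ n m → ¬ (m ≡ n) → coeff (monomial n) m ≈ 0#
  coeff-monomial-≢ zero    zero    m≢n = ⊥-elim (m≢n ≡.refl)
  coeff-monomial-≢ zero    (suc m) _   = refl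
  coeff-monomial-≢ (suc n) zero    _   = refl
  coeff-monomial-≢ (suc n) (suc m) m≢n = coeff-monomial-≢ n m (m≢n ∘ ≡.cong suc)

  Xpow-monomial : ∀ k n → Xpow k (monomial n) ≡ monomial (k +ℕ n)
  Xpow-monomial zero    n = ≡.refl
  Xpow-monomial (suc k) n = ≡.cong (0# ∷_) (Xpow-monomial k n)

  coeff-Xpow : ∀ k p u → coeff (Xpow k p) (k +ℕ u) ≡ coeff p u
  coeff-Xpow zero    p u = ≡.refl
  coeff-Xpow (suc k) p u = coeff-Xpow k p u

  Xpow-[] : ∀ k → Xpow k [] ≈ₚ []
  Xpow-[] zero    m       = refl
  Xpow-[] (suc k) zero    = refl
  Xpow-[] (suc k) (suc m) = Xpow-[] k m

  coeff-Xpow-∷ : ∀ a as k m →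
                 a * coeff (monomial k) m + coeff (Xpow (suc k) as) m ≈ coeff (Xpow k (a ∷ as)) m
  coeff-Xpow-∷ a as zero    zero    = trans (+-identityʳ _) (*-identityʳ a)
  coeff-Xpow-∷ a as zero    (suc m) = trans (+-congʳ (zeroʳ a)) (+-identityˡ _)
  coeff-Xpow-∷ a as (suc k) zero    = trans (+-identityʳ _) (zeroʳ a)
  coeff-Xpow-∷ a as (suc k) (suc m) = coeff-Xpow-∷ a as k m

  *ₚ-monomial : ∀ p k → (p *ₚ monomial k) ≈ₚ Xpow k p
  *ₚ-monomial []       k m = sym (Xpow-[] k m)
  *ₚ-monomial (a ∷ as) k m = begin
    coeff (scale a (monomial k) +ₚ (0# ∷ (as *ₚ monomial k))) m
      ≈⟨ coeff-+ₚ (scale a (monomial k)) _ m ⟩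
    coeff (scale a (monomial k)) m + coeff (0# ∷ (as *ₚ monomial k)) m
      ≈⟨ +-cong (coeff-scale a (monomial k) m) (tail m) ⟩
    a * coeff (monomial k) m + coeff (Xpow (suc k) as) m
      ≈⟨ coeff-Xpow-∷ a as k m ⟩
    coeff (Xpow k (a ∷ as)) m ∎
    where
    tail : ∀ m → coeff (0# ∷ (as *ₚ monomial k)) m ≈ coeff (Xpow (suc k) as) m
    tail zero    = refl
    tail (suc m) = *ₚ-monomial as k m

  degLessThan-*ₚmonomial⇒ : ∀ p k n → DegLessThan (p *ₚ monomial k) n → DegLessThan p (n ∸ k)
  degLessThan-*ₚmonomial⇒ p k n deg u n∸k≤u = begin
    coeff p u                        ≡⟨ coeff-Xpow k p u ⟨
    coeff (Xpow k p) (k +ℕ u)        ≈⟨ *ₚ-monomial p k (k +ℕ u) ⟨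
    coeff (p *ₚ monomial k) (k +ℕ u) ≈⟨ deg (k +ℕ u) (≤-trans (m≤n+m∸n n k) (+-monoʳ-≤ k n∸k≤u)) ⟩
    0#                               ∎

  module _ (charZero : CharZero) where

    natMul≈0⇒≈0 : ∀ n {y} → natMul (suc n) y ≈ 0# → y ≈ 0#
    natMul≈0⇒≈0 n {y} e = x*y≈0⇒y≈0 (charZero n) (trans (sym (natMul≈natMul1* (suc n) y)) e)

    coeff-Dpow≈0⇒coeff≈0 : ∀ j p i → coeff (Dpow j p) i ≈ 0# → coeff p (i +ℕ j) ≈ 0#
    coeff-Dpow≈0⇒coeff≈0 zero    p i c≈0 rewrite +ℕ-identityʳ i = c≈0
    coeff-Dpow≈0⇒coeff≈0 (suc j) p i c≈0 rewrite +-suc i j =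
      coeff-Dpow≈0⇒coeff≈0 j p (suc i) (natMul≈0⇒≈0 i (trans (sym (coeff-D (Dpow j p) i)) c≈0))

    Dpow≈0⇒degLessThan : ∀ j p → Dpow j p ≈ₚ [] → DegLessThan p j
    Dpow≈0⇒degLessThan j p D≈0 m j≤m =
      ≡.subst (λ m → coeff p m ≈ 0#) (m∸n+n≡m j≤m) (coeff-Dpow≈0⇒coeff≈0 j p (m ∸ j) (D≈0 (m ∸ j)))

    -- Reading off the coefficient of x^(n-j): only the term F j D^j survives there.
    applyD-monomial≈0⇒ : ∀ F n → applyD F (monomial n) ≈ₚ [] → OrdAtLeast F (suc n)
    applyD-monomial≈0⇒ F n applyD≈0′ j (s≤s j≤n) = x*y≈0⇒y≈0 d≉0 (begin
      d * F j                          ≈⟨ *-comm d (F j) ⟩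
      F j * d                          ≈⟨ coeff-scale (F j) (Dpow j (monomial n)) i ⟨
      coeff (term j) i                 ≈⟨ coeff-psum-single _ term i j j<len others ⟨
      coeff (applyD F (monomial n)) i  ≈⟨ applyD≈0′ i ⟩
      0#                               ∎)
      where
      i = n ∸ j
      term = λ k → scale (F k) (Dpow k (monomial n))
      d = coeff (Dpow j (monomial n)) i
      i+j≡n : i +ℕ j ≡ n
      i+j≡n = m∸n+n≡m j≤n
      d≉0 : ¬ (d ≈ 0#)
      d≉0 d≈0 = 0≉1 (begin
        0#                        ≈⟨ ≡.subst (λ m → coeff (monomial n) m ≈ 0#) i+j≡n
                                       (coeff-Dpow≈0⇒coeff≈0 j (monomial n) i d≈0) ⟨
        coeff (monomial n) n      ≈⟨ coeff-monomial-≡ n ⟩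
        1#                        ∎)
      j<len : j < suc (length (monomial n))
      j<len rewrite length-monomial n = s≤s (m≤n⇒m≤1+n j≤n)
      others : ∀ k → k < suc (length (monomial n)) → ¬ (k ≡ j) → coeff (term k) i ≈ 0#
      others k _ k≢j = trans (coeff-scale (F k) (Dpow k (monomial n)) i)
        (trans (*-congˡ (coeff-Dpow≈0 k (monomial n) i (coeff-monomial-≢ n (i +ℕ k) i+k≢n))) (zeroʳ _))
        where
        i+k≢n : ¬ (i +ℕ k ≡ n)
        i+k≢n e = k≢j (+-cancelˡ-≡ i k j (≡.trans e (≡.sym i+j≡n)))

    eventuallyZero⇒ordMinusIndexToInfinity :
      ∀ f → EventuallyZero (λ k p → applyD (f k) (Xpow k p)) → OrdMinusIndexToInfinity f
    eventuallyZero⇒ordMinusIndexToInfinity f ev M with ev (monomial M)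
    ... | N , vanish = N , λ k N≤k j j<k+M →
      applyD-monomial≈0⇒ (f k) (k +ℕ M)
        (≡.subst (λ q → applyD (f k) q ≈ₚ []) (Xpow-monomial k M) (vanish k N≤k))
        j (m≤n⇒m≤1+n j<k+M)

    eventuallyZero⇒indexMinusDegToInfinity :
      ∀ a → EventuallyZero (λ k p → Dpow k (mulOp (a k) p)) → IndexMinusDegToInfinity a
    eventuallyZero⇒indexMinusDegToInfinity a ev M with ev (monomial M)
    ... | N , vanish = N , λ k N≤k →
      degLessThan-mono (a k) (∸-monoˡ-≤ M (n≤1+n k))
        (degLessThan-*ₚmonomial⇒ (a k) M k (Dpow≈0⇒degLessThan k (a k *ₚ monomial M) (vanish k N≤k)))

mainTheorem6 : ∀ {c ℓ} (K : Field c ℓ) → Poly.CharZero K →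
    ((f : ℕ → Poly.PowerSeries K) →
      Poly.Converges K (λ k p → Poly.applyD K (f k) (Poly.Xpow K k p))
        ⇔ Poly.OrdMinusIndexToInfinity K f)
    ×
    ((a : ℕ → Poly.Pol K) →
      Poly.Converges K (λ k p → Poly.Dpow K k (Poly.mulOp K (a k) p))
        ⇔ Poly.IndexMinusDegToInfinity K a)
mainTheorem6 K charZero =
  (λ f → mk⇔ (eventuallyZero⇒ordMinusIndexToInfinity K charZero f ∘ converges⇒eventuallyZero K _)
             (eventuallyZero⇒converges K _ ∘ ordMinusIndexToInfinity⇒eventuallyZero K f)) ,
  (λ a → mk⇔ (eventuallyZero⇒indexMinusDegToInfinity K charZero a ∘ converges⇒eventuallyZero K _)
             (eventuallyZero⇒converges K _ ∘ indexMinusDegToInfinity⇒eventuallyZero K a))
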